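{- For all $\mathbb{N},\mathbb{N}_1,\mathbb{N}_2$ in $\widehat{\lambda}^{\text{↯}}_{\oplus}$ such that $\mathbb{N}\longrightarrow\mathbb{N}_1$, $\mathbb{N}\longrightarrow\mathbb{N}_2$ with $\mathbb{N}_1\ne\mathbb{N}_2$, there exists $\mathbb{M}$ such that $\mathbb{N}_1\longrightarrow\mathbb{M}$ and $\mathbb{N}_2\longrightarrow\mathbb{M}$.
   Context: $\widehat{\lambda}^{\text{↯}}_{\oplus}$ is a resource $\lambda$-calculus with sharing, non-determinism and failure: terms $M ::= x \mid \lambda x.(M[\widetilde{x}\leftarrow x]) \mid M\,B \mid M\langle\!\langle N/x\rangle\!\rangle \mid \mathtt{fail}^{\widetilde{x}} \mid M[\widetilde{x}\leftarrow x] \mid (M[\widetilde{x}\leftarrow x])\langle B/x\rangle$ (each shared variable occurring exactly once), bags are multisets of terms, expressions are sums. Reduction: $(\lambda x.M[\widetilde{x}\leftarrow x])B\longrightarrow M[\widetilde{x}\leftarrow x]\langle B/x\rangle$; $M[x_1,\dots,x_k\leftarrow x]\langle B/x\rangle\longrightarrow\sum_{B_i\in\mathrm{PER}(B)}M\langle\!\langle B_i(1)/x_1\rangle\!\rangle\cdots\langle\!\langle B_i(k)/x_k\rangle\!\rangle$ when $|B|=k\ge1$ and $M$ is not a failure; $M\langle\!\langle N/x\rangle\!\rangle\longrightarrow M\{\!|N/x|\!\}$ when $\mathrm{head}(M)=x$; failure when $k\ne|B|$; consumption rules for $\mathtt{fail}$ against bags, explicit substitutions and explicit linear substitutions; closure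 under term contexts and sum contexts. -}

module Defs where

open import Data.Nat using (ℕ; _≟_; _≤_)
open import Data.Bool using (if_then_else_)
open import Data.List using (List; []; _∷_; [_]; _++_; map; concatMap; filter; length)
open import Data.List.Relation.Unary.All using (All)
open import Data.Maybe using (Maybe; just; nothing)
open import Relation.Nullary using (¬_; ¬?; does)
open import Relation.Binary.PropositionalEquality using (_≡_; _≢_)
open import Data.List.Membership.DecPropositional _≟_ using (_∈_; _∈?_)

-- Variables are natural numbers (named syntax).
-- Bags (multisets of terms) are represented by lists of terms;
-- expressions (sums of terms) are represented by lists of terms.

data Term : Set where
  var   : ℕ → Term
  lam   : ℕ → Term → List ℕ → Term                    -- lam x M xs  =  λx.(M[xs ← x])
  app   : Term → List Term → Term
  lsub  : Term → Term → ℕ → Term                      -- lsub M N x  =  M⟨⟨N/x⟩⟩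
  fail  : List ℕ → Term
  share : Term → List ℕ → ℕ → Term                    -- share M xs x  =  M[xs ← x]
  esub  : Term → List ℕ → ℕ → List Term → Term        -- esub M xs x B  =  (M[xs ← x])⟨B/x⟩

Bag : Set
Bag = List Term

Expr : Set
Expr = List Term

-- List-of-variables operations: union is _++_, difference removes
-- every variable belonging to the second list.

_∖_ : List ℕ → List ℕ → List ℕ
xs ∖ zs = filter (λ v → ¬? (v ∈? zs)) xs

mutual
  fv : Term → List ℕ
  fv (var x)          = [ x ]
  fv (lam x M xs)     = ((fv M ∖ xs) ++ [ x ]) ∖ [ x ]
  fv (app M B)        = fv M ++ fvB B
  fv (lsub M N x)     = (fv M ∖ [ x ]) ++ fv N
  fv (fail xs)        = xs
  fv (share M xs x)   = (fv M ∖ xs) ++ [ x ]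
  fv (esub M xs x B)  = (fv M ∖ xs) ++ fvB B

  fvB : Bag → List ℕ
  fvB []      = []
  fvB (M ∷ B) = fv M ++ fvB B

headVar : Term → Maybe ℕ
headVar (var x) = just x
headVar (lam _ _ _) = nothing
headVar (app M _) = headVar M
headVar (lsub M _ x) with headVar M
... | nothing = nothing
... | just y  = if does (y ≟ x) then nothing else just y
headVar (fail _) = nothing
headVar (share M xs x) with headVar M
... | nothing = nothing
... | just y  = if does (y ∈? xs) then just x else just y
headVar (esub _ _ _ _) = nothing

lhs : Term → Term → ℕ → Term
lhs (var y) N x = if does (y ≟ x) then N else var y
lhs (lam y M ys) N x = lam y M ys
lhs (app M B) N x = app (lhs M N x) B
lhs (lsub M L y) N x = lsub (lhs M N x) L y
lhs (fail ys) N x = fail ys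
lhs (share M ys y) N x = share (lhs M N x) ys y
lhs (esub M ys y B) N x = esub (lhs M N x) ys y B

-- PER(B): all permutations of a bag (by positions, so |PER(B)| = |B|!)

insertions : {A : Set} → A → List A → List (List A)
insertions a [] = [ a ∷ [] ]
insertions a (b ∷ bs) = (a ∷ b ∷ bs) ∷ map (b ∷_) (insertions a bs)

perms : {A : Set} → List A → List (List A)
perms [] = [ [] ]
perms (a ∷ as) = concatMap (insertions a) (perms as)

-- M⟨⟨N₁/x₁⟩⟩⋯⟨⟨Nₖ/xₖ⟩⟩  (N₁ innermost)
lsubs : Term → List ℕ → List Term → Term
lsubs M (x ∷ xs) (N ∷ Ns) = lsubs (lsub M N x) xs Ns
lsubs M _ _ = M

infix 4 _⟶ₜ_ _⟶_

data _⟶ₜ_ : Term → Expr → Set where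
  beta : ∀ {x M xs B} →
         app (lam x M xs) B ⟶ₜ [ esub M xs x B ]
  exsub : ∀ {M xs x B} →
          1 ≤ length xs → length xs ≡ length B → (∀ ys → M ≢ fail ys) →
          esub M xs x B ⟶ₜ map (lsubs M xs) (perms B)
  linfetch : ∀ {M N x} → headVar M ≡ just x →
             lsub M N x ⟶ₜ [ lhs M N x ]
  failR : ∀ {M xs x B} → length xs ≢ length B →
          esub M xs x B ⟶ₜ map (λ _ → fail ((fv M ++ fvB B) ∖ xs)) (perms B)
  cons₁ : ∀ {xs B} →
          app (fail xs) B ⟶ₜ map (λ _ → fail (xs ++ fvB B)) (perms B)
  cons₂ : ∀ {vs zs x B} → length zs ≡ length B → All (_∈ vs) zs →
          esub (fail vs) zs x B ⟶ₜ map (λ _ → fail ((vs ∖ zs) ++ fvB B)) (perms B)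
  cons₃ : ∀ {vs N x} → x ∈ vs →
          lsub (fail vs) N x ⟶ₜ [ fail ((vs ∖ [ x ]) ++ fv N) ]
  ctx-app   : ∀ {M Ms B} → M ⟶ₜ Ms →
              app M B ⟶ₜ map (λ M′ → app M′ B) Ms
  ctx-lsub  : ∀ {M Ms N x} → M ⟶ₜ Ms →
              lsub M N x ⟶ₜ map (λ M′ → lsub M′ N x) Ms
  ctx-share : ∀ {M Ms xs x} → M ⟶ₜ Ms →
              share M xs x ⟶ₜ map (λ M′ → share M′ xs x) Ms

-- Reduction on expressions ([RS:ECont], sums up to AC via positions)

data _⟶_ : Expr → Expr → Set where
  step : ∀ {M Ms} (L R : Expr) → M ⟶ₜ Ms → (L ++ M ∷ R) ⟶ (L ++ Ms ++ R)

-- Term reduction is deterministic: the only rules that could overlap are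
-- separated by their side conditions (the bag-size test, and whether the body
-- is a failure), and the linear fetch cannot compete with a reduction inside
-- its body because a term with a head variable is normal. Hence two distinct
-- steps of a sum rewrite different summands, and these two steps commute.
module Submission where

open import Defs
open import Data.Empty using (⊥-elim)
open import Data.List using (List; []; _∷_; _++_; map)
open import Data.List.Properties using (++-assoc; ∷-injective)
open import Data.Maybe using (just; nothing)
open import Data.Bool.Properties using (T-≡)
open import Data.Nat.Properties using (≡⇒≡ᵇ)
open import Function.Bundles using (module Equivalence)
open import Data.Product using (∃; _×_; _,_; map₂; swap)
open import Relation.Binary.PropositionalEquality
  using (_≡_; _≢_; refl; sym; trans; cong; subst; subst₂)
open import Relation.Nullary using (¬_)

reducible⇒headVar≡nothing : ∀ {M Ms} → M ⟶ₜ Ms → headVar M ≡ nothing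
reducible⇒headVar≡nothing beta            = refl
reducible⇒headVar≡nothing (exsub _ _ _)   = refl
reducible⇒headVar≡nothing (linfetch {x = x} h)
  rewrite h | Equivalence.to T-≡ (≡⇒≡ᵇ x x refl) = refl
reducible⇒headVar≡nothing (failR _)       = refl
reducible⇒headVar≡nothing cons₁           = refl
reducible⇒headVar≡nothing (cons₂ _ _)     = refl
reducible⇒headVar≡nothing (cons₃ _)       = refl
reducible⇒headVar≡nothing (ctx-app r)     = reducible⇒headVar≡nothing r
reducible⇒headVar≡nothing (ctx-lsub r)
  rewrite reducible⇒headVar≡nothing r     = refl
reducible⇒headVar≡nothing (ctx-share r)
  rewrite reducible⇒headVar≡nothing r     = refl

headVar≡just⇒normal : ∀ {M Ms x} → headVar M ≡ just x → ¬ (M ⟶ₜ Ms)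
headVar≡just⇒normal h r with trans (sym h) (reducible⇒headVar≡nothing r)
... | ()

⟶ₜ-deterministic : ∀ {M Ms Ms′} → M ⟶ₜ Ms → M ⟶ₜ Ms′ → Ms ≡ Ms′
⟶ₜ-deterministic beta            beta            = refl
⟶ₜ-deterministic beta            (ctx-app ())
⟶ₜ-deterministic (exsub _ _ _)   (exsub _ _ _)   = refl
⟶ₜ-deterministic (exsub _ e _)   (failR e≢)      = ⊥-elim (e≢ e)
⟶ₜ-deterministic (exsub _ _ nf)  (cons₂ _ _)     = ⊥-elim (nf _ refl)
⟶ₜ-deterministic (failR e≢)      (exsub _ e _)   = ⊥-elim (e≢ e)
⟶ₜ-deterministic (failR _)       (failR _)       = refl
⟶ₜ-deterministic (failR e≢)      (cons₂ e _)     = ⊥-elim (e≢ e)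
⟶ₜ-deterministic (cons₂ _ _)     (exsub _ _ nf)  = ⊥-elim (nf _ refl)
⟶ₜ-deterministic (cons₂ e _)     (failR e≢)      = ⊥-elim (e≢ e)
⟶ₜ-deterministic (cons₂ _ _)     (cons₂ _ _)     = refl
⟶ₜ-deterministic (linfetch _)    (linfetch _)    = refl
⟶ₜ-deterministic (linfetch ())   (cons₃ _)
⟶ₜ-deterministic (linfetch h)    (ctx-lsub r)    = ⊥-elim (headVar≡just⇒normal h r)
⟶ₜ-deterministic cons₁           cons₁           = refl
⟶ₜ-deterministic cons₁           (ctx-app ())
⟶ₜ-deterministic (cons₃ _)       (linfetch ())
⟶ₜ-deterministic (cons₃ _)       (cons₃ _)       = refl
⟶ₜ-deterministic (cons₃ _)       (ctx-lsub ())
⟶ₜ-deterministic (ctx-app ())    beta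
⟶ₜ-deterministic (ctx-app ())    cons₁
⟶ₜ-deterministic (ctx-app r)     (ctx-app r′)    = cong (map _) (⟶ₜ-deterministic r r′)
⟶ₜ-deterministic (ctx-lsub r)    (linfetch h)    = ⊥-elim (headVar≡just⇒normal h r)
⟶ₜ-deterministic (ctx-lsub ())   (cons₃ _)
⟶ₜ-deterministic (ctx-lsub r)    (ctx-lsub r′)   = cong (map _) (⟶ₜ-deterministic r r′)
⟶ₜ-deterministic (ctx-share r)   (ctx-share r′)  = cong (map _) (⟶ₜ-deterministic r r′)

data Decompositions {A : Set} (L₁ : List A) (x : A) (R₁ : List A)
                              (L₂ : List A) (y : A) (R₂ : List A) : Set where
  same   : L₁ ≡ L₂ → x ≡ y → R₁ ≡ R₂ → Decompositions L₁ x R₁ L₂ y R₂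
  before : ∀ C → L₂ ≡ L₁ ++ x ∷ C → R₁ ≡ C ++ y ∷ R₂ → Decompositions L₁ x R₁ L₂ y R₂
  after  : ∀ C → L₁ ≡ L₂ ++ y ∷ C → R₂ ≡ C ++ x ∷ R₁ → Decompositions L₁ x R₁ L₂ y R₂

decompositions : ∀ {A : Set} (L₁ : List A) x R₁ L₂ y R₂ →
                 L₁ ++ x ∷ R₁ ≡ L₂ ++ y ∷ R₂ → Decompositions L₁ x R₁ L₂ y R₂
decompositions []       x R₁ []       y R₂ refl = same refl refl refl
decompositions []       x R₁ (_ ∷ L₂) y R₂ refl = before L₂ refl refl
decompositions (_ ∷ L₁) x R₁ []       y R₂ refl = after L₁ refl refl
decompositions (_ ∷ L₁) x R₁ (_ ∷ L₂) y R₂ eq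
  with refl , eq′ ← ∷-injective eq
  with decompositions L₁ x R₁ L₂ y R₂ eq′
... | same   refl refl refl = same refl refl refl
... | before C refl refl    = before C refl refl
... | after  C refl refl    = after C refl refl

Joinable : Expr → Expr → Set
Joinable N₁ N₂ = ∃ λ M → (N₁ ⟶ M) × (N₂ ⟶ M)

joinable-sym : ∀ {N₁ N₂} → Joinable N₁ N₂ → Joinable N₂ N₁
joinable-sym = map₂ swap

disjoint-steps-joinable : ∀ L C R {M₁ M₂ Ms₁ Ms₂} → M₁ ⟶ₜ Ms₁ → M₂ ⟶ₜ Ms₂ →
  Joinable (L ++ Ms₁ ++ C ++ M₂ ∷ R) (L ++ M₁ ∷ C ++ Ms₂ ++ R)
disjoint-steps-joinable L C R {Ms₁ = Ms₁} r₁ r₂ =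
  _ , subst₂ _⟶_ (reassoc _) (reassoc _) (step (L ++ Ms₁ ++ C) R r₂)
    , step L (C ++ _ ++ R) r₁
  where
  reassoc : ∀ X → (L ++ Ms₁ ++ C) ++ X ≡ L ++ Ms₁ ++ C ++ X
  reassoc X = trans (++-assoc L _ X) (cong (L ++_) (++-assoc Ms₁ C X))

-- N is kept apart from the decomposition of the first step so that matching
-- on the second step needs no unification of two list decompositions.
step-joinable : ∀ L₁ R₁ {N N₂ M₁ Ms₁} → M₁ ⟶ₜ Ms₁ → N ≡ L₁ ++ M₁ ∷ R₁ →
  N ⟶ N₂ → L₁ ++ Ms₁ ++ R₁ ≢ N₂ → Joinable (L₁ ++ Ms₁ ++ R₁) N₂
step-joinable L₁ R₁ {M₁ = M₁} r₁ eq (step {M₂} L₂ R₂ r₂) distinct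
  with decompositions L₁ M₁ R₁ L₂ M₂ R₂ (sym eq)
... | same refl refl refl =
  ⊥-elim (distinct (cong (λ Ms → L₁ ++ Ms ++ R₁) (⟶ₜ-deterministic r₁ r₂)))
... | before C refl refl =
  subst (Joinable _) (sym (++-assoc L₁ (M₁ ∷ C) _)) (disjoint-steps-joinable L₁ C R₂ r₁ r₂)
... | after C refl refl =
  subst (λ N₁ → Joinable N₁ _) (sym (++-assoc L₂ (M₂ ∷ C) _))
    (joinable-sym (disjoint-steps-joinable L₂ C R₁ r₂ r₁))

proposition3p9 : ∀ (N N₁ N₂ : Expr) → N ⟶ N₁ → N ⟶ N₂ → N₁ ≢ N₂ →
                 ∃ λ M → (N₁ ⟶ M) × (N₂ ⟶ M)
proposition3p9 _ _ _ (step L₁ R₁ r₁) s₂ distinct = step-joinable L₁ R₁ r₁ refl s₂ distinct
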